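{- Let $G$ be a 2-connected outerplanar near-triangulation with $V(G)=\{u,v_1,\dots,v_{2k-1}\}$, $k>1$, $N_G(u)=\{v_1,\dots,v_{2k-1}\}$, $\deg_G(v_1)=\deg_G(v_{2k-1})=2$, and $v_1,\dots,v_{2k-1}$ ordered counter-clockwise (consecutively along the outer cycle). Given $l$ with $2\le l<2k-1$, the monomial $\eta_l\,u^2v_1^1v_{2k-1}^1v_l^1\prod_{i\notin\{1,2k-1,l\}}v_i^2$ does not vanish in $P(G)$ (i.e. $\eta_l\neq0$) if and only if $l$ is even. Moreover, if $\eta_l\neq0$ then $|\eta_l|=1$.
   Context: For a graph $G$, vertices are also variables and $P(G)=\prod_{xy\in E(G),\,x<y}(x-y)$ for a fixed arbitrary orientation; $\eta_l$ denotes the coefficient of the indicated monomial in $P(G)$. A 2-connected outerplanar near-triangulation is a 2-connected outerplanar graph embedded with all vertices on the outer cycle and all bounded faces triangles. -}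

module Defs where

open import Data.Nat using (ℕ; zero; suc; _+_; _∸_; _<_; _≤_; _<ᵇ_; _≡ᵇ_)
open import Data.Bool using (Bool; true; false; _∧_; _∨_; if_then_else_)
open import Data.Fin using (Fin; toℕ; _≟_)
open import Data.List using (List; []; _∷_; [_]; concatMap; foldr; length; filterᵇ; map; allFin)
open import Data.Integer as ℤ using (ℤ)
open import Data.Product using (_×_; _,_; ∃-syntax)
open import Data.Sum using (_⊎_)
open import Data.Empty using (⊥)
open import Relation.Binary.PropositionalEquality using (_≡_)
open import Relation.Nullary using (¬_)

Graph : ℕ → Set
Graph n = Fin n → Fin n → Bool

record IsSimple {n : ℕ} (E : Graph n) : Set where
  field
    sym     : ∀ i j → E i j ≡ E j i
    irrefl  : ∀ i → E i i ≡ false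

deg : {n : ℕ} → Graph n → Fin n → ℕ
deg {n} E i = length (filterᵇ (λ j → E i j) (allFin n))

-- 2-connected outerplanar near-triangulation whose outer cycle is
-- 0, 1, 2, …, n-1 (in this cyclic order).  Vertices lie on the outer
-- cycle; chords are drawn inside, so two chords ac, bd with a<b<c<d
-- would cross.  "All bounded faces are triangles" means no further
-- chord can be drawn inside without crossing an existing edge.

Between : {n : ℕ} → Fin n → Fin n → Fin n → Set
Between i x j = toℕ i < toℕ x × toℕ x < toℕ j

Outside : {n : ℕ} → Fin n → Fin n → Fin n → Set
Outside i x j = toℕ x < toℕ i ⊎ toℕ j < toℕ x

record IsOuterplanarNearTriangulation {n : ℕ} (E : Graph n) : Set where
  field
    simple      : IsSimple E
    atLeast3    : 3 ≤ n
    cycleEdge   : ∀ i j → toℕ j ≡ suc (toℕ i) → E i j ≡ true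
    closingEdge : ∀ i j → toℕ i ≡ 0 → toℕ j ≡ n ∸ 1 → E i j ≡ true
    noCrossing  : ∀ a b c d → toℕ a < toℕ b → toℕ b < toℕ c → toℕ c < toℕ d →
                  E a c ≡ true → E b d ≡ true → ⊥
    triangulated : ∀ i j → toℕ i < toℕ j → E i j ≡ false →
                   ∃[ a ] ∃[ b ] (E a b ≡ true × Between i a j × Outside i b j)

-- Multivariate integer polynomials in variables x_0,…,x_{n-1},
-- represented as (unreduced) lists of terms (coefficient, exponent vector).

Monomial : ℕ → Set
Monomial n = Fin n → ℕ

Poly : ℕ → Set
Poly n = List (ℤ × Monomial n)

oneP : {n : ℕ} → Poly n
oneP = [ ℤ.+ 1 , (λ _ → 0) ]

var : {n : ℕ} → Fin n → Monomial n
var i j with i ≟ j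
... | Relation.Nullary.yes _ = 1
... | Relation.Nullary.no  _ = 0

diffP : {n : ℕ} → Fin n → Fin n → Poly n
diffP i j = (ℤ.+ 1 , var i) ∷ (ℤ.- ℤ.+ 1 , var j) ∷ []

_*P_ : {n : ℕ} → Poly n → Poly n → Poly n
p *P q = concatMap (λ { (c , e) → map (λ { (d , f) → (c ℤ.* d , λ v → e v + f v) }) q }) p

_≡ᴹ_ : {n : ℕ} → Monomial n → Monomial n → Bool
_≡ᴹ_ {n} e f = foldr (λ v b → (e v ≡ᵇ f v) ∧ b) true (allFin n)

coeff : {n : ℕ} → Poly n → Monomial n → ℤ
coeff p e = foldr (λ { (c , f) acc → if f ≡ᴹ e then c ℤ.+ acc else acc }) (ℤ.+ 0) p

-- Graph polynomial P(G) = ∏_{xy ∈ E(G), x<y} (x - y), orientation fixed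
-- by the vertex labelling.

edgeList : {n : ℕ} → Graph n → List (Fin n × Fin n)
edgeList {n} E =
  concatMap (λ i → concatMap (λ j → if E i j ∧ (toℕ i <ᵇ toℕ j) then [ (i , j) ] else [])
                               (allFin n))
            (allFin n)

graphPoly : {n : ℕ} → Graph n → Poly n
graphPoly E = foldr (λ { (i , j) acc → diffP i j *P acc }) oneP (edgeList E)

-- The monomial of Corollary 4.10, with u = 0, v_i = i, n = 2k:
-- u^2 v_1 v_{2k-1} v_l ∏_{i ∉ {1,2k-1,l}} v_i^2.

etaMonomial : (n l : ℕ) → Monomial n
etaMonomial n l v =
  if (toℕ v ≡ᵇ 0) then 2
  else if (toℕ v ≡ᵇ 1) ∨ (toℕ v ≡ᵇ (n ∸ 1)) ∨ (toℕ v ≡ᵇ l) then 1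
  else 2

module Submission where

open import Defs
open import Data.Bool using (Bool; true; false; _∧_; _∨_; if_then_else_; T)
import Data.Bool.Properties as Bool
open import Data.Empty using (⊥-elim)
open import Data.Fin using (Fin; toℕ; _≟_; fromℕ<) renaming (zero to fzero; suc to fsuc)
open import Data.Fin.Properties using (toℕ<n; toℕ-fromℕ<; toℕ-injective)
open import Data.Integer as ℤ using (ℤ; ∣_∣; -_; _-_; 0ℤ; 1ℤ; -1ℤ) renaming (+_ to ℤ+)
import Data.Integer.Properties as ℤ
open import Data.Integer.Solver using (module +-*-Solver)
open import Data.List using (List; []; _∷_; [_]; _++_; foldr; map; concatMap; tabulate; allFin)
open import Data.List.Properties using (++-identityʳ; map-concatMap; concatMap-cong; concatMap-map)
open import Data.List.Relation.Binary.Permutation.Propositional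
  using (_↭_) renaming (refl to ↭-refl; prep to ↭-prep; swap to ↭-swap; trans to ↭-trans)
open import Data.List.Relation.Binary.Permutation.Propositional.Properties using () renaming (shift to ↭-shift)
open import Data.List.Relation.Unary.All using (All; []; _∷_)
open import Data.List.Relation.Unary.All.Properties using (tabulate⁺; tabulate⁻)
open import Data.Nat using (ℕ; zero; suc; _+_; _*_; _∸_; _<_; _≤_; _≡ᵇ_; _<ᵇ_; z≤n; s≤s; parity)
import Data.Nat.Properties as ℕ
open import Data.Nat.Divisibility using (_∣_; divides; ∣-refl; ∣m∣n⇒∣m+n)
open import Data.Parity.Base using (Parity; 0ℙ; 1ℙ; _⁻¹)
import Data.Parity.Properties as ℙ
open import Data.Product using (_×_; _,_)
open import Data.Vec as Vec using (Vec; []; _∷_)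
open import Data.Vec.Properties using (tabulate-cong)
open import Function using (_∘_; Equivalence; _⇔_; mk⇔)
open import Relation.Binary.PropositionalEquality
  using (_≡_; refl; sym; trans; cong; cong₂; subst; subst₂; _≗_; _≢_; module ≡-Reasoning)
open import Relation.Nullary using (¬_; yes; no)

-- Since u = 0 is adjacent to every vertex, no chord between two other vertices fits into the
-- outerplanar embedding, so G is the fan with spokes 0v and path edges v(v+1), and P(G) is
-- ∏ (u − v) ∏ (v − (v+1)).  Multiply the factors out in the order 0s, s(s+1), 0(s+1), …  Once the
-- factors at s are used, s never reappears, so at each stage the coefficient sought only depends on
-- the exponents still owed to u and to the current vertex, both at most 2: a 3 × 3 table.  Passing
-- from s + 1 to s is a linear map on such tables that only depends on whether s + 1 is owed 1 or 2.
-- On the tables that occur these maps have period 2, so the table at s is determined by the parities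
-- of s and l (the last vertex 2k − 1 being odd), and its entry at s = 1 is −1 for even l, 0 for odd l.

≡ᵇ-refl : ∀ n → (n ≡ᵇ n) ≡ true
≡ᵇ-refl n = Equivalence.to Bool.T-≡ (ℕ.≡⇒≡ᵇ n n refl)

≢⇒≡ᵇ≡false : ∀ {m n} → m ≢ n → (m ≡ᵇ n) ≡ false
≢⇒≡ᵇ≡false {m} {n} m≢n with m ≡ᵇ n in eq
... | false = refl
... | true  = ⊥-elim (m≢n (ℕ.≡ᵇ⇒≡ m n (Equivalence.from Bool.T-≡ eq)))

-- Coefficients of products of differences

ifPos : ℕ → ℤ → ℤ
ifPos zero    _ = 0ℤ
ifPos (suc _) x = x

ifPos-0 : ∀ m → ifPos m 0ℤ ≡ 0ℤ
ifPos-0 zero    = refl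
ifPos-0 (suc _) = refl

ifPos-neg : ∀ m x → ifPos m (- x) ≡ - ifPos m x
ifPos-neg zero    x = refl
ifPos-neg (suc _) x = refl

ifPos-− : ∀ m x y → ifPos m (x - y) ≡ ifPos m x - ifPos m y
ifPos-− zero    x y = refl
ifPos-− (suc _) x y = refl

ifPos-comm : ∀ m m′ x → ifPos m (ifPos m′ x) ≡ ifPos m′ (ifPos m x)
ifPos-comm zero    zero    x = refl
ifPos-comm zero    (suc _) x = refl
ifPos-comm (suc _) zero    x = refl
ifPos-comm (suc _) (suc _) x = refl

var-self : ∀ {n} (i : Fin n) → var i i ≡ 1
var-self i with i ≟ i
... | yes _   = refl
... | no  i≢i = ⊥-elim (i≢i refl)

foldr-∧≡true⇒All : ∀ {A : Set} (P : A → Bool) xs →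
  foldr (λ x b → P x ∧ b) true xs ≡ true → All (λ x → P x ≡ true) xs
foldr-∧≡true⇒All P []       _  = []
foldr-∧≡true⇒All P (x ∷ xs) eq with P x in px
... | true = px ∷ foldr-∧≡true⇒All P xs eq

All⇒foldr-∧≡true : ∀ {A : Set} (P : A → Bool) {xs} →
  All (λ x → P x ≡ true) xs → foldr (λ x b → P x ∧ b) true xs ≡ true
All⇒foldr-∧≡true P []         = refl
All⇒foldr-∧≡true P (px ∷ pxs) rewrite px = All⇒foldr-∧≡true P pxs

module _ {n : ℕ} where

  ≡ᴹ⇒≗ : {e f : Monomial n} → (e ≡ᴹ f) ≡ true → e ≗ f
  ≡ᴹ⇒≗ {e} {f} eq v = ℕ.≡ᵇ⇒≡ _ _ (Equivalence.from Bool.T-≡ (tabulate⁻ pointwise v))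
    where pointwise = foldr-∧≡true⇒All (λ v → e v ≡ᵇ f v) (allFin n) eq

  ≗⇒≡ᴹ : {e f : Monomial n} → e ≗ f → (e ≡ᴹ f) ≡ true
  ≗⇒≡ᴹ {e} {f} e≗f =
    All⇒foldr-∧≡true (λ v → e v ≡ᵇ f v) (tabulate⁺ λ v → Equivalence.to Bool.T-≡ (ℕ.≡⇒≡ᵇ _ _ (e≗f v)))

  ≡ᴹ-congʳ : (e : Monomial n) {f f′ : Monomial n} → f ≗ f′ → (e ≡ᴹ f) ≡ (e ≡ᴹ f′)
  ≡ᴹ-congʳ e {f} {f′} f≗f′ = Bool.⇔→≡ (mk⇔
    (λ eq → ≗⇒≡ᴹ (λ v → trans (≡ᴹ⇒≗ {e} {f} eq v) (f≗f′ v)))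
    (λ eq → ≗⇒≡ᴹ (λ v → trans (≡ᴹ⇒≗ {e} {f′} eq v) (sym (f≗f′ v)))))

  coeff-congʳ : (p : Poly n) {e e′ : Monomial n} → e ≗ e′ → coeff p e ≡ coeff p e′
  coeff-congʳ []            e≗e′ = refl
  coeff-congʳ ((c , f) ∷ p) e≗e′ =
    cong₂ (λ b r → if b then c ℤ.+ r else r) (≡ᴹ-congʳ f e≗e′) (coeff-congʳ p e≗e′)

  coeff-++ : (p q : Poly n) (e : Monomial n) → coeff (p ++ q) e ≡ coeff p e ℤ.+ coeff q e
  coeff-++ []            q e = sym (ℤ.+-identityˡ _)
  coeff-++ ((c , f) ∷ p) q e with f ≡ᴹ e
  ... | true  = trans (cong (λ r → c ℤ.+ r) (coeff-++ p q e)) (sym (ℤ.+-assoc c _ _))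
  ... | false = coeff-++ p q e


  _-x_ : Monomial n → Fin n → Monomial n
  (e -x i) v = e v ∸ var i v

  _·x_ : Fin n → Monomial n → Monomial n
  (i ·x f) v = var i v + f v

  ·x≡⇔≡-x : ∀ {i : Fin n} {e f} m → e i ≡ suc m → ∀ v → (i ·x f) v ≡ e v ⇔ f v ≡ (e -x i) v
  ·x≡⇔≡-x {i} {e} {f} m ei v with i ≟ v
  ... | no  _    = mk⇔ (λ eq → eq) (λ eq → eq)
  ... | yes refl = mk⇔ (cong (_∸ 1)) (λ eq → trans (cong suc eq) (ℕ.m+[n∸m]≡n 1≤ei))
    where 1≤ei = subst (1 ≤_) (sym ei) (s≤s z≤n)

  ·x≡ᴹ≡≡ᴹ-x : ∀ {i : Fin n} {e} f m → e i ≡ suc m → ((i ·x f) ≡ᴹ e) ≡ (f ≡ᴹ (e -x i))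
  ·x≡ᴹ≡≡ᴹ-x {i} {e} f m ei = Bool.⇔→≡ (mk⇔
    (λ eq → ≗⇒≡ᴹ λ v → Equivalence.to (·x≡⇔≡-x {i} {e} {f} m ei v) (≡ᴹ⇒≗ {i ·x f} {e} eq v))
    (λ eq → ≗⇒≡ᴹ λ v → Equivalence.from (·x≡⇔≡-x {i} {e} {f} m ei v) (≡ᴹ⇒≗ {f} {e -x i} eq v)))

  ·x≡ᴹ≡false : ∀ {i : Fin n} {e} f → e i ≡ 0 → ((i ·x f) ≡ᴹ e) ≡ false
  ·x≡ᴹ≡false {i} {e} f ei with (i ·x f) ≡ᴹ e in eq
  ... | false = refl
  ... | true  = ⊥-elim (ℕ.1+n≢0 (begin
    suc (f i)       ≡⟨ cong (_+ f i) (sym (var-self i)) ⟩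
    (i ·x f) i      ≡⟨ ≡ᴹ⇒≗ {i ·x f} {e} eq i ⟩
    e i             ≡⟨ ei ⟩
    0               ∎))
    where open ≡-Reasoning

  mulTerm : ℤ → Fin n → ℤ × Monomial n → ℤ × Monomial n
  mulTerm s i (d , f) = (s ℤ.* d , i ·x f)

  coeff-map-mulTerm : ∀ s i q (e : Monomial n) →
    coeff (map (mulTerm s i) q) e ≡ ifPos (e i) (s ℤ.* coeff q (e -x i))
  coeff-map-mulTerm s i q e with e i in ei
  ... | zero = vanish q
    where
    vanish : ∀ q → coeff (map (mulTerm s i) q) e ≡ 0ℤ
    vanish []            = refl
    vanish ((d , f) ∷ q) rewrite ·x≡ᴹ≡false {i} {e} f ei = vanish q
  ... | suc m = shifted q
    where
    shifted : ∀ q → coeff (map (mulTerm s i) q) e ≡ s ℤ.* coeff q (e -x i)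
    shifted []            = sym (ℤ.*-zeroʳ s)
    shifted ((d , f) ∷ q) rewrite ·x≡ᴹ≡≡ᴹ-x {i} {e} f m ei with f ≡ᴹ (e -x i)
    ... | true  = trans (cong (λ r → s ℤ.* d ℤ.+ r) (shifted q)) (sym (ℤ.*-distribˡ-+ s d _))
    ... | false = shifted q

  coeff-diffP* : ∀ i j p (e : Monomial n) →
    coeff (diffP i j *P p) e ≡ ifPos (e i) (coeff p (e -x i)) - ifPos (e j) (coeff p (e -x j))
  coeff-diffP* i j p e = begin
    coeff (map (mulTerm (ℤ+ 1) i) p ++ map (mulTerm (- ℤ+ 1) j) p ++ []) e
      ≡⟨ coeff-++ (map (mulTerm (ℤ+ 1) i) p) _ e ⟩
    coeff (map (mulTerm (ℤ+ 1) i) p) e ℤ.+ coeff (map (mulTerm (- ℤ+ 1) j) p ++ []) e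
      ≡⟨ cong₂ ℤ._+_ (coeff-map-mulTerm (ℤ+ 1) i p e)
                     (trans (cong (λ q → coeff q e) (++-identityʳ (map (mulTerm (- ℤ+ 1) j) p)))
                            (coeff-map-mulTerm (- ℤ+ 1) j p e)) ⟩
    ifPos (e i) (ℤ+ 1 ℤ.* coeff p (e -x i)) ℤ.+ ifPos (e j) (- ℤ+ 1 ℤ.* coeff p (e -x j))
      ≡⟨ cong₂ ℤ._+_ (cong (ifPos (e i)) (ℤ.*-identityˡ _))
                     (trans (cong (ifPos (e j)) (ℤ.-1*i≡-i _)) (ifPos-neg (e j) _)) ⟩
    ifPos (e i) (coeff p (e -x i)) - ifPos (e j) (coeff p (e -x j)) ∎
    where open ≡-Reasoning

_-δ_ : (ℕ → ℕ) → ℕ → ℕ → ℕ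
(g -δ a) x = g x ∸ (if x ≡ᵇ a then 1 else 0)

-δ-self : ∀ g a → (g -δ a) a ≡ g a ∸ 1
-δ-self g a rewrite ≡ᵇ-refl a = refl

-δ-other : ∀ g {a x} → x ≢ a → (g -δ a) x ≡ g x
-δ-other g x≢a rewrite ≢⇒≡ᵇ≡false x≢a = refl

-δ-congˡ : ∀ {g g′} a → g ≗ g′ → g -δ a ≗ g′ -δ a
-δ-congˡ a g≗g′ x = cong (_∸ (if x ≡ᵇ a then 1 else 0)) (g≗g′ x)

-δ-comm : ∀ g a c → (g -δ a) -δ c ≗ (g -δ c) -δ a
-δ-comm g a c x = begin
  g x ∸ α ∸ γ    ≡⟨ ℕ.∸-+-assoc (g x) α γ ⟩
  g x ∸ (α + γ)  ≡⟨ cong (g x ∸_) (ℕ.+-comm α γ) ⟩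
  g x ∸ (γ + α)  ≡⟨ ℕ.∸-+-assoc (g x) γ α ⟨
  g x ∸ γ ∸ α    ∎
  where
  open ≡-Reasoning
  α γ : ℕ
  α = if x ≡ᵇ a then 1 else 0
  γ = if x ≡ᵇ c then 1 else 0

coeffProd : ℕ → List (ℕ × ℕ) → (ℕ → ℕ) → ℤ
coeffProd n []             g = coeff (oneP {n}) (g ∘ toℕ)
coeffProd n ((a , b) ∷ es) g =
  ifPos (g a) (coeffProd n es (g -δ a)) - ifPos (g b) (coeffProd n es (g -δ b))

coeffProd-cong : ∀ n es {g g′} → g ≗ g′ → coeffProd n es g ≡ coeffProd n es g′
coeffProd-cong n []             g≗g′ = coeff-congʳ (oneP {n}) (g≗g′ ∘ toℕ)
coeffProd-cong n ((a , b) ∷ es) g≗g′ =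
  cong₂ _-_ (cong₂ ifPos (g≗g′ a) (coeffProd-cong n es (-δ-congˡ a g≗g′)))
            (cong₂ ifPos (g≗g′ b) (coeffProd-cong n es (-δ-congˡ b g≗g′)))

toℕ² : ∀ {n} → Fin n × Fin n → ℕ × ℕ
toℕ² (i , j) = (toℕ i , toℕ j)

-x≗-δ : ∀ {n} {e : Monomial n} {g} → e ≗ g ∘ toℕ → ∀ i → e -x i ≗ (g -δ toℕ i) ∘ toℕ
-x≗-δ {g = g} e≗g i v = cong₂ _∸_ (e≗g v) var≡ind
  where
  var≡ind : var i v ≡ (if toℕ v ≡ᵇ toℕ i then 1 else 0)
  var≡ind with i ≟ v
  ... | yes refl rewrite ≡ᵇ-refl (toℕ i) = refl
  ... | no  i≢v  rewrite ≢⇒≡ᵇ≡false (i≢v ∘ sym ∘ toℕ-injective) = refl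

coeff-foldr-diffP : ∀ {n} (F : Fin n × Fin n → Poly n → Poly n) →
  (∀ i j p → F (i , j) p ≡ diffP i j *P p) →
  ∀ es {e : Monomial n} {g} → e ≗ g ∘ toℕ →
  coeff (foldr F oneP es) e ≡ coeffProd n (map toℕ² es) g
coeff-foldr-diffP F F≡ []             e≗g = coeff-congʳ oneP e≗g
coeff-foldr-diffP F F≡ ((i , j) ∷ es) {e} {g} e≗g =
  trans (cong (λ p → coeff p e) (F≡ i j (foldr F oneP es)))
  (trans (coeff-diffP* i j (foldr F oneP es) e)
    (cong₂ _-_ (cong₂ ifPos (e≗g i) (coeff-foldr-diffP F F≡ es (-x≗-δ {g = g} e≗g i)))
               (cong₂ ifPos (e≗g j) (coeff-foldr-diffP F F≡ es (-x≗-δ {g = g} e≗g j)))))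

module _ (n : ℕ) where

  private
    interchange : ∀ p q r s → (p - q) - (r - s) ≡ (p - r) - (q - s)
    interchange = solve 4 (λ p q r s → (p :- q) :- (r :- s) := (p :- r) :- (q :- s)) refl
      where open +-*-Solver

  coeffProd-swap : ∀ x y es g → coeffProd n (x ∷ y ∷ es) g ≡ coeffProd n (y ∷ x ∷ es) g
  coeffProd-swap (a , b) (c , d) es g = begin
    ifPos (g a) (twice′ a c - twice′ a d) - ifPos (g b) (twice′ b c - twice′ b d)
      ≡⟨ cong₂ _-_ (ifPos-− (g a) _ _) (ifPos-− (g b) _ _) ⟩
    (twice a c - twice a d) - (twice b c - twice b d)
      ≡⟨ interchange (twice a c) (twice a d) (twice b c) (twice b d) ⟩
    (twice a c - twice b c) - (twice a d - twice b d)
      ≡⟨ cong₂ _-_ (cong₂ _-_ (twice-sym a c) (twice-sym b c))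
                   (cong₂ _-_ (twice-sym a d) (twice-sym b d)) ⟩
    (twice c a - twice c b) - (twice d a - twice d b)
      ≡⟨ cong₂ _-_ (ifPos-− (g c) _ _) (ifPos-− (g d) _ _) ⟨
    ifPos (g c) (twice′ c a - twice′ c b) - ifPos (g d) (twice′ d a - twice′ d b) ∎
    where
    open ≡-Reasoning
    twice′ : ℕ → ℕ → ℤ
    twice′ x y = ifPos ((g -δ x) y) (coeffProd n es ((g -δ x) -δ y))
    twice : ℕ → ℕ → ℤ
    twice x y = ifPos (g x) (twice′ x y)
    twice-sym : ∀ x y → twice x y ≡ twice y x
    twice-sym x y with x ℕ.≟ y
    ... | yes refl = refl
    ... | no  x≢y  = begin
      ifPos (g x) (ifPos ((g -δ x) y) (coeffProd n es ((g -δ x) -δ y)))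
        ≡⟨ cong₂ (λ m r → ifPos (g x) (ifPos m r))
                 (-δ-other g (x≢y ∘ sym)) (coeffProd-cong n es (-δ-comm g x y)) ⟩
      ifPos (g x) (ifPos (g y) (coeffProd n es ((g -δ y) -δ x)))
        ≡⟨ ifPos-comm (g x) (g y) _ ⟩
      ifPos (g y) (ifPos (g x) (coeffProd n es ((g -δ y) -δ x)))
        ≡⟨ cong (λ m → ifPos (g y) (ifPos m (coeffProd n es ((g -δ y) -δ x)))) (-δ-other g x≢y) ⟨
      ifPos (g y) (ifPos ((g -δ y) x) (coeffProd n es ((g -δ y) -δ x))) ∎

  coeffProd-prep : ∀ {xs ys} → (∀ g → coeffProd n xs g ≡ coeffProd n ys g) →
                   ∀ x g → coeffProd n (x ∷ xs) g ≡ coeffProd n (x ∷ ys) g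
  coeffProd-prep xs≡ys (a , b) g =
    cong₂ _-_ (cong (ifPos (g a)) (xs≡ys (g -δ a))) (cong (ifPos (g b)) (xs≡ys (g -δ b)))

  coeffProd-↭ : ∀ {xs ys} → xs ↭ ys → ∀ g → coeffProd n xs g ≡ coeffProd n ys g
  coeffProd-↭ ↭-refl g = refl
  coeffProd-↭ (↭-prep {xs = xs} {ys} x p) g = coeffProd-prep {xs} {ys} (coeffProd-↭ p) x g
  coeffProd-↭ (↭-swap {xs = xs} {ys} x y p) g =
    trans (coeffProd-swap x y xs g)
          (coeffProd-prep {x ∷ xs} {x ∷ ys} (coeffProd-prep {xs} {ys} (coeffProd-↭ p) x) y g)
  coeffProd-↭ (↭-trans p q) g = trans (coeffProd-↭ p g) (coeffProd-↭ q g)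

Avoids : ℕ → ℕ × ℕ → Set
Avoids v (a , b) = a ≢ v × b ≢ v

0≡ᴹ≡false : ∀ {n} (g : ℕ → ℕ) {v} → v < n → g v ≢ 0 →
            ((λ (_ : Fin n) → 0) ≡ᴹ (g ∘ toℕ)) ≡ false
0≡ᴹ≡false {n} g {v} v<n gv≢0 with (λ (_ : Fin n) → 0) ≡ᴹ (g ∘ toℕ) in eq
... | false = refl
... | true  = ⊥-elim (gv≢0 (sym (begin
  0                    ≡⟨ ≡ᴹ⇒≗ {e = λ _ → 0} {g ∘ toℕ} eq (fromℕ< v<n) ⟩
  g (toℕ (fromℕ< v<n)) ≡⟨ cong g (toℕ-fromℕ< v<n) ⟩
  g v                  ∎)))
  where open ≡-Reasoning

coeffProd-unused : ∀ n es g {v} → v < n → All (Avoids v) es → g v ≢ 0 → coeffProd n es g ≡ 0ℤ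
coeffProd-unused n [] g v<n [] gv≢0 rewrite 0≡ᴹ≡false g v<n gv≢0 = refl
coeffProd-unused n ((a , b) ∷ es) g {v} v<n ((a≢v , b≢v) ∷ avoids) gv≢0 =
  cong₂ _-_ (vanish a (a≢v ∘ sym)) (vanish b (b≢v ∘ sym))
  where
  vanish : ∀ x → v ≢ x → ifPos (g x) (coeffProd n es (g -δ x)) ≡ 0ℤ
  vanish x v≢x = trans (cong (ifPos (g x)) (coeffProd-unused n es (g -δ x) v<n avoids still≢0)) (ifPos-0 (g x))
    where still≢0 = gv≢0 ∘ trans (sym (-δ-other g v≢x))

coeffProd-[]-zero : ∀ n g → (∀ v → v < n → g v ≡ 0) → coeffProd n [] g ≡ ℤ+ 1
coeffProd-[]-zero n g g≡0
  rewrite ≗⇒≡ᴹ {e = λ _ → 0} {g ∘ toℕ} (λ v → sym (g≡0 (toℕ v) (toℕ<n v))) = refl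

fanArc : ℕ → ℕ → Bool
fanArc zero    zero    = false
fanArc zero    (suc _) = true
fanArc (suc a) b       = b ≡ᵇ suc (suc a)

fanArc-≥ : ∀ a b → b ≤ a → fanArc a b ≡ false
fanArc-≥ zero    zero _   = refl
fanArc-≥ (suc a) b    b≤a = ≢⇒≡ᵇ≡false (λ b≡ → ℕ.<-irrefl b≡ (s≤s b≤a))

-- The graph is the fan

module _ {n : ℕ} (E : Graph (suc n)) (ont : IsOuterplanarNearTriangulation E)
         (hub : ∀ (u i : Fin (suc n)) → toℕ u ≡ 0 → toℕ i ≢ 0 → E u i ≡ true) where
  open IsOuterplanarNearTriangulation ont

  -- A chord ab with 0 < a < a + 1 < b would cross the spoke from 0 to a + 1.
  edge≡fanArc : ∀ i j → toℕ i < toℕ j → E i j ≡ fanArc (toℕ i) (toℕ j)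
  edge≡fanArc i j i<j with toℕ i in ti | toℕ j in tj
  ... | zero  | suc b = hub i j ti (λ tj≡0 → ℕ.1+n≢0 (trans (sym tj) tj≡0))
  ... | suc a | b with b ℕ.≟ suc (suc a)
  ...   | yes refl rewrite ≡ᵇ-refl a = cycleEdge i j (trans tj (cong suc (sym ti)))
  ...   | no  b≢  rewrite ≢⇒≡ᵇ≡false b≢ with E i j in eij
  ...     | false = refl
  ...     | true  = ⊥-elim (noCrossing fzero i x j
                       (subst (0 <_) (sym ti) (s≤s z≤n))
                       (subst₂ _<_ (sym ti) (sym tx) (ℕ.n<1+n (suc a)))
                       (subst₂ _<_ (sym tx) (sym tj) a+1<b)
                       (hub fzero x refl (λ tx≡0 → ℕ.1+n≢0 (trans (sym tx) tx≡0))) eij)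
    where
    a+1<b : suc (suc a) < b
    a+1<b = ℕ.≤∧≢⇒< i<j (b≢ ∘ sym)
    a+1<n : suc (suc a) < suc n
    a+1<n = ℕ.<-trans a+1<b (subst (_< suc n) tj (toℕ<n j))
    x : Fin (suc n)
    x = fromℕ< a+1<n
    tx : toℕ x ≡ suc (suc a)
    tx = toℕ-fromℕ< a+1<n

  arc≡fanArc : ∀ i j → E i j ∧ (toℕ i <ᵇ toℕ j) ≡ fanArc (toℕ i) (toℕ j)
  arc≡fanArc i j with toℕ i <ᵇ toℕ j in lt
  ... | false = trans (Bool.∧-zeroʳ (E i j))
                      (sym (fanArc-≥ (toℕ i) (toℕ j) (ℕ.≮⇒≥ (λ i<j → subst T lt (ℕ.<⇒<ᵇ i<j)))))
  ... | true  = trans (Bool.∧-identityʳ (E i j))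
                      (edge≡fanArc i j (ℕ.<ᵇ⇒< (toℕ i) (toℕ j) (subst T (sym lt) _)))

interval : ℕ → ℕ → List ℕ
interval s zero    = []
interval s (suc r) = s ∷ interval (suc s) r

map-toℕ-tabulate : ∀ {n} m s (h : Fin m → Fin n) → (∀ i → toℕ (h i) ≡ s + toℕ i) →
                   map toℕ (tabulate h) ≡ interval s m
map-toℕ-tabulate zero    s h h≡ = refl
map-toℕ-tabulate (suc m) s h h≡ =
  cong₂ _∷_ (trans (h≡ fzero) (ℕ.+-identityʳ s))
            (map-toℕ-tabulate m (suc s) (h ∘ fsuc) (λ i → trans (h≡ (fsuc i)) (ℕ.+-suc s (toℕ i))))

map-toℕ-allFin : ∀ n → map toℕ (allFin n) ≡ interval 0 n
map-toℕ-allFin n = map-toℕ-tabulate n 0 (λ i → i) (λ i → refl)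

fanCell : ℕ → ℕ → List (ℕ × ℕ)
fanCell a b = if fanArc a b then [ (a , b) ] else []

fanRow : ℕ → ℕ → List (ℕ × ℕ)
fanRow n a = concatMap (fanCell a) (interval 0 n)

edgeList≡fanRows : ∀ {n} (E : Graph n) →
  (∀ i j → E i j ∧ (toℕ i <ᵇ toℕ j) ≡ fanArc (toℕ i) (toℕ j)) →
  map toℕ² (edgeList E) ≡ concatMap (fanRow n) (interval 0 n)
edgeList≡fanRows {n} E arc≡ = begin
  map toℕ² (concatMap row (allFin n))            ≡⟨ map-concatMap toℕ² row (allFin n) ⟩
  concatMap (map toℕ² ∘ row) (allFin n)          ≡⟨ concatMap-cong row≡ (allFin n) ⟩
  concatMap (fanRow n ∘ toℕ) (allFin n)          ≡⟨ over-toℕ (fanRow n) ⟩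
  concatMap (fanRow n) (interval 0 n)            ∎
  where
  open ≡-Reasoning
  cell : Fin n → Fin n → List (Fin n × Fin n)
  cell i j = if E i j ∧ (toℕ i <ᵇ toℕ j) then [ (i , j) ] else []
  row : Fin n → List (Fin n × Fin n)
  row i = concatMap (cell i) (allFin n)
  over-toℕ : ∀ {B : Set} (f : ℕ → List B) →
             concatMap (f ∘ toℕ) (allFin n) ≡ concatMap f (interval 0 n)
  over-toℕ f = trans (sym (concatMap-map f toℕ (allFin n))) (cong (concatMap f) (map-toℕ-allFin n))
  map-cell : ∀ i j → map toℕ² (cell i j) ≡ fanCell (toℕ i) (toℕ j)
  map-cell i j with E i j ∧ (toℕ i <ᵇ toℕ j) | arc≡ i j
  ... | true  | eq rewrite sym eq = refl
  ... | false | eq rewrite sym eq = refl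
  row≡ : ∀ i → map toℕ² (row i) ≡ fanRow n (toℕ i)
  row≡ i = begin
    map toℕ² (row i)                             ≡⟨ map-concatMap toℕ² (cell i) (allFin n) ⟩
    concatMap (map toℕ² ∘ cell i) (allFin n)     ≡⟨ concatMap-cong (map-cell i) (allFin n) ⟩
    concatMap (fanCell (toℕ i) ∘ toℕ) (allFin n) ≡⟨ over-toℕ (fanCell (toℕ i)) ⟩
    fanRow n (toℕ i)                             ∎

spokes : ℕ → ℕ → List (ℕ × ℕ)
spokes s zero    = []
spokes s (suc r) = (0 , s) ∷ spokes (suc s) r

path : ℕ → ℕ → List (ℕ × ℕ)
path s zero    = []
path s (suc r) = (s , suc s) ∷ path (suc s) r

fanFrom : ℕ → ℕ → List (ℕ × ℕ)
fanFrom s zero    = [ (0 , s) ]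
fanFrom s (suc r) = (0 , s) ∷ (s , suc s) ∷ fanFrom (suc s) r

module _ (h : ℕ → ℕ × ℕ) (c : ℕ) where

  private
    hit : ℕ → List (ℕ × ℕ)
    hit b = if b ≡ᵇ c then [ h b ] else []

  concatMap-hit-below : ∀ r s → c < s → concatMap hit (interval s r) ≡ []
  concatMap-hit-below zero    s c<s = refl
  concatMap-hit-below (suc r) s c<s rewrite ≢⇒≡ᵇ≡false (ℕ.>⇒≢ c<s) =
    concatMap-hit-below r (suc s) (ℕ.m<n⇒m<1+n c<s)

  concatMap-hit-above : ∀ r s → s + r ≤ c → concatMap hit (interval s r) ≡ []
  concatMap-hit-above zero    s _   = refl
  concatMap-hit-above (suc r) s s+r≤c
    rewrite ≢⇒≡ᵇ≡false (ℕ.<⇒≢ (ℕ.<-≤-trans (ℕ.m<m+n s (s≤s z≤n)) s+r≤c)) =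
    concatMap-hit-above r (suc s) (subst (_≤ c) (ℕ.+-suc s r) s+r≤c)

  concatMap-hit-inside : ∀ r s → s ≤ c → c < s + r → concatMap hit (interval s r) ≡ [ h c ]
  concatMap-hit-inside zero    s s≤c c<s+0 = ⊥-elim (ℕ.<⇒≱ (subst (c <_) (ℕ.+-identityʳ s) c<s+0) s≤c)
  concatMap-hit-inside (suc r) s s≤c c<s+r with s ℕ.≟ c
  ... | yes refl rewrite ≡ᵇ-refl s = cong (h s ∷_) (concatMap-hit-below r (suc s) (ℕ.n<1+n s))
  ... | no  s≢c  rewrite ≢⇒≡ᵇ≡false s≢c =
    concatMap-hit-inside r (suc s) (ℕ.≤∧≢⇒< s≤c s≢c) (subst (c <_) (ℕ.+-suc s r) c<s+r)

fanRow-0 : ∀ r s → concatMap (fanCell 0) (interval (suc s) r) ≡ spokes (suc s) r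
fanRow-0 zero    s = refl
fanRow-0 (suc r) s = cong ((0 , suc s) ∷_) (fanRow-0 r (suc s))

fanRow-path : ∀ N r s → s + r ≡ N →
              concatMap (fanRow (suc (suc N))) (interval (suc s) (suc r)) ≡ path (suc s) r
fanRow-path N zero s s+0≡N =
  cong (_++ []) (concatMap-hit-above (suc s ,_) (suc (suc s)) (suc (suc N)) 0 (s≤s (s≤s N≤s)))
  where N≤s = ℕ.≤-reflexive (trans (sym s+0≡N) (ℕ.+-identityʳ s))
fanRow-path N (suc r) s s+r+1≡N =
  cong₂ _++_ (concatMap-hit-inside (suc s ,_) (suc (suc s)) (suc (suc N)) 0 z≤n (s≤s (s≤s s<N)))
             (fanRow-path N r (suc s) (trans (sym (ℕ.+-suc s r)) s+r+1≡N))
  where s<N = subst (s <_) s+r+1≡N (ℕ.m<m+n s (s≤s z≤n))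

fanRows≡spokes++path : ∀ N →
  concatMap (fanRow (suc (suc N))) (interval 0 (suc (suc N))) ≡ spokes 1 (suc N) ++ path 1 N
fanRows≡spokes++path N = cong₂ _++_ (fanRow-0 (suc N) 0) (fanRow-path N N 0 refl)

spokes++path↭fanFrom : ∀ r s → spokes s (suc r) ++ path s r ↭ fanFrom s r
spokes++path↭fanFrom zero    s = ↭-refl
spokes++path↭fanFrom (suc r) s =
  ↭-prep (0 , s) (↭-trans (↭-shift (s , suc s) (spokes (suc s) (suc r)) (path (suc s) r))
                           (↭-prep (s , suc s) (spokes++path↭fanFrom r (suc s))))

-- Expanding the fan vertex by vertex

front : ℕ → ℕ → (ℕ → ℕ) → ℕ → ℕ
front zero    t η zero    = t
front zero    t η (suc v) = η (suc v)
front (suc s) t η zero    = 0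
front (suc s) t η (suc v) = front s t (η ∘ suc) v

front-at : ∀ s t η → front s t η s ≡ t
front-at zero    t η = refl
front-at (suc s) t η = front-at s t (η ∘ suc)

front-next : ∀ s t η → front s t η (suc s) ≡ η (suc s)
front-next zero    t η = refl
front-next (suc s) t η = front-next s t (η ∘ suc)

front-empty : ∀ s η v → v ≤ s → front s 0 η v ≡ 0
front-empty zero    η zero    _         = refl
front-empty (suc s) η zero    _         = refl
front-empty (suc s) η (suc v) (s≤s v≤s) = front-empty s (η ∘ suc) v v≤s

front-lower : ∀ s t η → front s t η -δ s ≗ front s (t ∸ 1) η
front-lower zero    t η zero    = refl
front-lower zero    t η (suc v) = refl
front-lower (suc s) t η zero    = refl
front-lower (suc s) t η (suc v) = front-lower s t (η ∘ suc) v

front-advance₁ : ∀ s η → front s 1 η -δ s ≗ front (suc s) (η (suc s)) η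
front-advance₁ zero    η zero          = refl
front-advance₁ zero    η (suc zero)    = refl
front-advance₁ zero    η (suc (suc v)) = refl
front-advance₁ (suc s) η zero          = refl
front-advance₁ (suc s) η (suc v)       = front-advance₁ s (η ∘ suc) v

front-advance₀ : ∀ s η → front s 0 η -δ suc s ≗ front (suc s) (η (suc s) ∸ 1) η
front-advance₀ zero    η zero          = refl
front-advance₀ zero    η (suc zero)    = refl
front-advance₀ zero    η (suc (suc v)) = refl
front-advance₀ (suc s) η zero          = refl
front-advance₀ (suc s) η (suc v)       = front-advance₀ s (η ∘ suc) v

-- Exponents still owed once the factors at the vertices before s are used: c by u, none by
-- 1, …, s − 1, t by s, and the full target η v by every v > s.
frontier : (ℕ → ℕ) → ℕ → ℕ → ℕ → ℕ → ℕ
frontier η s c t zero    = c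
frontier η s c t (suc v) = front s t η (suc v)

frontier-lowerOrigin : ∀ η s c t → frontier η s c t -δ 0 ≗ frontier η s (c ∸ 1) t
frontier-lowerOrigin η s c t zero    = refl
frontier-lowerOrigin η s c t (suc v) = refl

frontier-δ : ∀ η {s s′ t t′} a c → front s t η -δ suc a ≗ front s′ t′ η →
             frontier η s c t -δ suc a ≗ frontier η s′ c t′
frontier-δ η a c eq zero    = refl
frontier-δ η a c eq (suc v) = eq (suc v)

Table : Set
Table = ℕ → ℕ → ℤ

-- After the spoke 0s, the path edge s(s+1) must use up what is left of the exponent t of s;
-- e is the target exponent of s + 1.
pathStep : ℕ → Table → Table
pathStep e T c zero          = - ifPos e (T c (e ∸ 1))
pathStep e T c (suc zero)    = T c e
pathStep e T c (suc (suc _)) = 0ℤ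

transfer : ℕ → Table → Table
transfer e T c t = ifPos c (pathStep e T (c ∸ 1) t) - ifPos t (pathStep e T c (t ∸ 1))

oneTable : ℕ → ℕ → ℤ
oneTable zero zero = ℤ+ 1
oneTable _    _    = 0ℤ

spokeTable : Table
spokeTable c t = ifPos c (oneTable (c ∸ 1) t) - ifPos t (oneTable c (t ∸ 1))

fanFrom-avoids : ∀ r {s v} → 0 < v → v < s → All (Avoids v) (fanFrom s r)
fanFrom-avoids zero    0<v v<s = (ℕ.<⇒≢ 0<v , ℕ.>⇒≢ v<s) ∷ []
fanFrom-avoids (suc r) 0<v v<s =
  (ℕ.<⇒≢ 0<v , ℕ.>⇒≢ v<s) ∷ (ℕ.>⇒≢ v<s , ℕ.>⇒≢ v<s+1) ∷ fanFrom-avoids r 0<v v<s+1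
  where v<s+1 = ℕ.m<n⇒m<1+n v<s

module _ (N : ℕ) (η : ℕ → ℕ) where

  private
    n = suc (suc N)

  fanCoeff : ℕ → ℕ → Table
  fanCoeff s r c t = coeffProd n (fanFrom s r) (frontier η s c t)

  coeffProd-fanFrom-unused : ∀ s r h {m} → 0 < s → s < n → h s ≡ suc m →
                             coeffProd n (fanFrom (suc s) r) h ≡ 0ℤ
  coeffProd-fanFrom-unused s r h 0<s s<n hs≡1+m =
    coeffProd-unused n (fanFrom (suc s) r) h s<n (fanFrom-avoids r 0<s (ℕ.n<1+n s))
                     (ℕ.1+n≢0 ∘ trans (sym hs≡1+m))

  frontier-owedBy-s : ∀ s c t {a} → suc s ≢ a → (frontier η (suc s) c t -δ a) (suc s) ≡ t
  frontier-owedBy-s s c t s+1≢a = trans (-δ-other (frontier η (suc s) c t) s+1≢a) (front-at s t (η ∘ suc))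

  coeffProd-pathStep : ∀ s r c t → suc s < n →
    coeffProd n ((suc s , suc (suc s)) ∷ fanFrom (suc (suc s)) r) (frontier η (suc s) c t)
      ≡ pathStep (η (suc (suc s))) (fanCoeff (suc (suc s)) r) c t
  coeffProd-pathStep s r c t s+1<n
    rewrite front-at s t (η ∘ suc) | front-next s t (η ∘ suc) with t
  ... | zero = begin
    0ℤ - ifPos e (coeffProd n F (frontier η (suc s) c 0 -δ suc (suc s)))
      ≡⟨ ℤ.+-identityˡ _ ⟩
    - ifPos e (coeffProd n F (frontier η (suc s) c 0 -δ suc (suc s)))
      ≡⟨ cong (λ x → - ifPos e x) (coeffProd-cong n F (frontier-δ η (suc s) c (front-advance₀ (suc s) η))) ⟩
    - ifPos e (fanCoeff (suc (suc s)) r c (e ∸ 1))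
      ∎
    where
    open ≡-Reasoning
    e = η (suc (suc s))
    F = fanFrom (suc (suc s)) r
  ... | suc zero = begin
    coeffProd n F (g -δ suc s) - ifPos e (coeffProd n F (g -δ suc (suc s)))
      ≡⟨ cong₂ (λ x y → x - ifPos e y)
               (coeffProd-cong n F (frontier-δ η s c (front-advance₁ (suc s) η)))
               (coeffProd-fanFrom-unused (suc s) r _ (s≤s z≤n) s+1<n (frontier-owedBy-s s c 1 s+1≢s+2)) ⟩
    fanCoeff (suc (suc s)) r c e - ifPos e 0ℤ
      ≡⟨ trans (cong (λ y → fanCoeff (suc (suc s)) r c e - y) (ifPos-0 e)) (ℤ.+-identityʳ _) ⟩
    fanCoeff (suc (suc s)) r c e
      ∎
    where
    open ≡-Reasoning
    e = η (suc (suc s))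
    F = fanFrom (suc (suc s)) r
    g = frontier η (suc s) c 1
    s+1≢s+2 = ℕ.<⇒≢ (ℕ.n<1+n (suc s))
  ... | suc (suc t) =
    trans (cong₂ (λ x y → x - ifPos e y)
                 (coeffProd-fanFrom-unused (suc s) r _ (s≤s z≤n) s+1<n lowered)
                 (coeffProd-fanFrom-unused (suc s) r _ (s≤s z≤n) s+1<n
                                           (frontier-owedBy-s s c (suc (suc t)) s+1≢s+2)))
          (cong (λ y → 0ℤ - y) (ifPos-0 e))
    where
    e = η (suc (suc s))
    g = frontier η (suc s) c (suc (suc t))
    s+1≢s+2 = ℕ.<⇒≢ (ℕ.n<1+n (suc s))
    lowered : (g -δ suc s) (suc s) ≡ suc t
    lowered = trans (-δ-self g (suc s)) (cong (_∸ 1) (front-at s (suc (suc t)) (η ∘ suc)))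

  fanCoeff-transfer : ∀ s r → suc s < n → ∀ c t →
    fanCoeff (suc s) (suc r) c t ≡ transfer (η (suc (suc s))) (fanCoeff (suc (suc s)) r) c t
  fanCoeff-transfer s r s+1<n c t = begin
    ifPos c (coeffProd n P (g -δ 0)) - ifPos (front s t (η ∘ suc) s) (coeffProd n P (g -δ suc s))
      ≡⟨ cong₂ (λ x y → ifPos c x - y)
           (coeffProd-cong n P (frontier-lowerOrigin η (suc s) c t))
           (cong₂ ifPos (front-at s t (η ∘ suc))
                        (coeffProd-cong n P
                          (frontier-δ η {s′ = suc s} {t′ = t ∸ 1} s c (front-lower (suc s) t η)))) ⟩
    ifPos c (coeffProd n P (frontier η (suc s) (c ∸ 1) t))
      - ifPos t (coeffProd n P (frontier η (suc s) c (t ∸ 1)))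
      ≡⟨ cong₂ (λ x y → ifPos c x - ifPos t y)
           (coeffProd-pathStep s r (c ∸ 1) t s+1<n) (coeffProd-pathStep s r c (t ∸ 1) s+1<n) ⟩
    transfer (η (suc (suc s))) (fanCoeff (suc (suc s)) r) c t
      ∎
    where
    open ≡-Reasoning
    P = (suc s , suc (suc s)) ∷ fanFrom (suc (suc s)) r
    g = frontier η (suc s) c t

  fanCoeff-last : ∀ c t → fanCoeff (suc N) 0 c t ≡ spokeTable c t
  fanCoeff-last c t = cong₂ (λ x y → ifPos c x - y)
    (trans (coeffProd-cong n [] (frontier-lowerOrigin η (suc N) c t)) (empty (c ∸ 1) t))
    (cong₂ ifPos (front-at N t (η ∘ suc))
      (trans (coeffProd-cong n [] (frontier-δ η {s′ = suc N} {t′ = t ∸ 1} N c (front-lower (suc N) t η)))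
             (empty c (t ∸ 1))))
    where
    empty : ∀ c t → coeffProd n [] (frontier η (suc N) c t) ≡ oneTable c t
    empty zero zero = coeffProd-[]-zero n (frontier η (suc N) 0 0) nothingOwed
      where
      nothingOwed : ∀ v → v < n → frontier η (suc N) 0 0 v ≡ 0
      nothingOwed zero    _           = refl
      nothingOwed (suc v) (s≤s v≤N+1) = front-empty (suc N) η (suc v) v≤N+1
    empty (suc c) t       = coeffProd-unused n [] (frontier η (suc N) (suc c) t) (s≤s z≤n) [] (λ ())
    empty zero    (suc t) = coeffProd-unused n [] (frontier η (suc N) 0 (suc t)) (ℕ.n<1+n (suc N)) []
                              (ℕ.1+n≢0 ∘ trans (sym (front-at N (suc t) (η ∘ suc))))

-- Tables on exponents at most 2

-- Rows are indexed by the exponent c owed by u, columns by the exponent t owed by the current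
-- vertex; as every target exponent is at most 2, no other entries are ever read.
Grid : Set
Grid = Vec (Vec ℤ 3) 3

grid : Table → Grid
grid T = Vec.tabulate λ c → Vec.tabulate λ t → T (toℕ c) (toℕ t)

private
  at : ∀ {m} → Vec ℤ m → ℕ → ℤ
  at []        _       = 0ℤ
  at (x ∷ _)  zero    = x
  at (_ ∷ xs) (suc i) = at xs i

table : Grid → Table
table G c t = at (Vec.map (λ row → at row t) G) c

stepGrid : ℕ → Grid → Grid
stepGrid e G = grid (transfer e (table G))

grid-cong : ∀ {T T′} → (∀ c t → T c t ≡ T′ c t) → grid T ≡ grid T′
grid-cong T≡T′ = tabulate-cong λ c → tabulate-cong λ t → T≡T′ (toℕ c) (toℕ t)

grid-transfer : ∀ e → e ≤ 2 → ∀ T → grid (transfer e T) ≡ stepGrid e (grid T)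
grid-transfer 0 _ T = refl
grid-transfer 1 _ T = refl
grid-transfer 2 _ T = refl
grid-transfer (suc (suc (suc _))) (s≤s (s≤s ())) T

beyondGrid : Parity → Grid
beyondGrid 0ℙ = (  0ℤ ∷ 0ℤ ∷  1ℤ ∷ [])
              ∷ (  0ℤ ∷ 0ℤ ∷  0ℤ ∷ [])
              ∷ (-1ℤ ∷ 0ℤ ∷  0ℤ ∷ []) ∷ []
beyondGrid 1ℙ = (  0ℤ ∷ 0ℤ ∷ -1ℤ ∷ [])
              ∷ (  0ℤ ∷ 1ℤ ∷  0ℤ ∷ [])
              ∷ (  0ℤ ∷ 0ℤ ∷  0ℤ ∷ []) ∷ []

beforeGrid : Parity → Parity → Grid
beforeGrid 0ℙ _  = (0ℤ ∷   0ℤ ∷  0ℤ ∷ [])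
                 ∷ (0ℤ ∷   0ℤ ∷  0ℤ ∷ [])
                 ∷ (0ℤ ∷ -1ℤ ∷  0ℤ ∷ []) ∷ []
beforeGrid 1ℙ 0ℙ = (0ℤ ∷   0ℤ ∷  0ℤ ∷ [])
                 ∷ (0ℤ ∷   0ℤ ∷ -1ℤ ∷ [])
                 ∷ (0ℤ ∷   1ℤ ∷  0ℤ ∷ []) ∷ []
beforeGrid 1ℙ 1ℙ = (0ℤ ∷   0ℤ ∷  0ℤ ∷ [])
                 ∷ (0ℤ ∷   0ℤ ∷  1ℤ ∷ [])
                 ∷ (0ℤ ∷   0ℤ ∷  0ℤ ∷ []) ∷ []

stepGrid-spokeTable : stepGrid 1 (grid spokeTable) ≡ beyondGrid 0ℙ
stepGrid-spokeTable = refl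

stepGrid-beyond : ∀ p → stepGrid 2 (beyondGrid p) ≡ beyondGrid (p ⁻¹)
stepGrid-beyond 0ℙ = refl
stepGrid-beyond 1ℙ = refl

stepGrid-cross : ∀ p → stepGrid 1 (beyondGrid p) ≡ beforeGrid p (p ⁻¹)
stepGrid-cross 0ℙ = refl
stepGrid-cross 1ℙ = refl

stepGrid-before : ∀ q p → stepGrid 2 (beforeGrid q p) ≡ beforeGrid q (p ⁻¹)
stepGrid-before 0ℙ 0ℙ = refl
stepGrid-before 0ℙ 1ℙ = refl
stepGrid-before 1ℙ 0ℙ = refl
stepGrid-before 1ℙ 1ℙ = refl

etaCoefficient : Parity → ℤ
etaCoefficient 0ℙ = -1ℤ
etaCoefficient 1ℙ = 0ℤ

etaℕ : ℕ → ℕ → ℕ → ℕ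
etaℕ n l x = if (x ≡ᵇ 0) then 2 else if (x ≡ᵇ 1) ∨ (x ≡ᵇ (n ∸ 1)) ∨ (x ≡ᵇ l) then 1 else 2

etaℕ-≤2 : ∀ n l x → etaℕ n l x ≤ 2
etaℕ-≤2 n l x with x ≡ᵇ 0 | (x ≡ᵇ 1) ∨ (x ≡ᵇ (n ∸ 1)) ∨ (x ≡ᵇ l)
... | true  | _     = ℕ.≤-refl
... | false | true  = s≤s z≤n
... | false | false = ℕ.≤-refl

etaℕ-at-l : ∀ n {l} → 2 ≤ l → etaℕ n l l ≡ 1
etaℕ-at-l n {suc zero}    (s≤s ())
etaℕ-at-l n {suc (suc l)} _ rewrite ≡ᵇ-refl l | Bool.∨-zeroʳ (suc (suc l) ≡ᵇ (n ∸ 1)) = refl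

module _ (N l : ℕ) (2≤l : 2 ≤ l) (l≤N : l ≤ N) (N-even : parity N ≡ 0ℙ) where

  private
    n = suc (suc N)
    η = etaℕ n l

  η-last : η (suc N) ≡ 1
  η-last rewrite ≡ᵇ-refl N | Bool.∨-zeroʳ (suc N ≡ᵇ 1) = refl

  η-at-l : η l ≡ 1
  η-at-l = etaℕ-at-l n 2≤l

  η-inner : ∀ v → 2 ≤ v → v ≢ suc N → v ≢ l → η v ≡ 2
  η-inner (suc (suc v)) (s≤s (s≤s z≤n)) v≢N+1 v≢l rewrite ≢⇒≡ᵇ≡false v≢N+1 | ≢⇒≡ᵇ≡false v≢l = refl

  fanGrid : ℕ → Grid
  fanGrid s = grid (fanCoeff N η s (suc N ∸ s))

  fanGrid-step : ∀ s → s < N → fanGrid (suc s) ≡ stepGrid (η (suc (suc s))) (fanGrid (suc (suc s)))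
  fanGrid-step s s<N = begin
    grid (fanCoeff N η (suc s) (N ∸ s))
      ≡⟨ cong (grid ∘ fanCoeff N η (suc s)) (ℕ.+-∸-assoc 1 s<N) ⟩
    grid (fanCoeff N η (suc s) (suc (N ∸ suc s)))
      ≡⟨ grid-cong (fanCoeff-transfer N η s (N ∸ suc s) (s≤s (ℕ.m<n⇒m<1+n s<N))) ⟩
    grid (transfer (η (suc (suc s))) (fanCoeff N η (suc (suc s)) (N ∸ suc s)))
      ≡⟨ grid-transfer (η (suc (suc s))) (etaℕ-≤2 n l (suc (suc s))) (fanCoeff N η (suc (suc s)) (N ∸ suc s)) ⟩
    stepGrid (η (suc (suc s))) (fanGrid (suc (suc s)))
      ∎
    where open ≡-Reasoning

  fanGrid-last : fanGrid (suc N) ≡ grid spokeTable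
  fanGrid-last rewrite ℕ.n∸n≡0 N = grid-cong (fanCoeff-last N η)

  fanGrid-beyond : ∀ d s → s + d ≡ N → l ≤ s → fanGrid s ≡ beyondGrid (parity s)
  fanGrid-beyond d zero _ l≤0 = ⊥-elim (ℕ.<⇒≱ (ℕ.<-≤-trans (s≤s z≤n) 2≤l) l≤0)
  fanGrid-beyond zero (suc s) s+1+0≡N _ with trans (sym (ℕ.+-identityʳ (suc s))) s+1+0≡N
  ... | refl = begin
    fanGrid (suc s)                                     ≡⟨ fanGrid-step s (ℕ.n<1+n s) ⟩
    stepGrid (η (suc (suc s))) (fanGrid (suc (suc s)))  ≡⟨ cong₂ stepGrid η-last fanGrid-last ⟩
    stepGrid 1 (grid spokeTable)                        ≡⟨ stepGrid-spokeTable ⟩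
    beyondGrid 0ℙ                                       ≡⟨ cong beyondGrid N-even ⟨
    beyondGrid (parity (suc s))                         ∎
    where open ≡-Reasoning
  fanGrid-beyond (suc d) (suc s) s+1+d+1≡N l≤s+1 = begin
    fanGrid (suc s)                                     ≡⟨ fanGrid-step s (ℕ.<⇒≤ s+1<N) ⟩
    stepGrid (η (suc (suc s))) (fanGrid (suc (suc s)))  ≡⟨ cong₂ stepGrid η≡2 next ⟩
    stepGrid 2 (beyondGrid (parity s))                  ≡⟨ stepGrid-beyond (parity s) ⟩
    beyondGrid (parity s ⁻¹)                            ≡⟨ cong beyondGrid (ℙ.suc-homo-⁻¹ (suc s)) ⟩
    beyondGrid (parity (suc s))                         ∎
    where
    open ≡-Reasoning
    s+2+d≡N = trans (sym (ℕ.+-suc (suc s) d)) s+1+d+1≡N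
    next = fanGrid-beyond d (suc (suc s)) s+2+d≡N (ℕ.m≤n⇒m≤1+n l≤s+1)
    s+1<N : suc s < N
    s+1<N = subst (suc (suc s) ≤_) s+2+d≡N (ℕ.m≤m+n (suc (suc s)) d)
    η≡2 : η (suc (suc s)) ≡ 2
    η≡2 = η-inner (suc (suc s)) (s≤s (s≤s z≤n)) (ℕ.<⇒≢ (s≤s s+1<N)) (ℕ.>⇒≢ (s≤s l≤s+1))

  fanGrid-before : ∀ d s → s + suc d ≡ l → 0 < s → fanGrid s ≡ beforeGrid (parity l) (parity s)
  fanGrid-before zero (suc s) s+1+1≡l _ with trans (sym (ℕ.+-comm (suc s) 1)) s+1+1≡l
  ... | refl = begin
    fanGrid (suc s)                                ≡⟨ fanGrid-step s (ℕ.<⇒≤ l≤N) ⟩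
    stepGrid (η l) (fanGrid l)                     ≡⟨ cong₂ stepGrid η-at-l beyond ⟩
    stepGrid 1 (beyondGrid (parity l))             ≡⟨ stepGrid-cross (parity l) ⟩
    beforeGrid (parity l) (parity l ⁻¹)            ≡⟨ cong (beforeGrid (parity l)) (ℙ.suc-homo-⁻¹ (suc s)) ⟩
    beforeGrid (parity l) (parity (suc s))         ∎
    where
    open ≡-Reasoning
    beyond = fanGrid-beyond (N ∸ l) l (ℕ.m+[n∸m]≡n l≤N) ℕ.≤-refl
  fanGrid-before (suc d) (suc s) s+1+d+2≡l _ = begin
    fanGrid (suc s)                                     ≡⟨ fanGrid-step s (ℕ.≤-trans (ℕ.<⇒≤ (ℕ.<⇒≤ s+2<l)) l≤N) ⟩
    stepGrid (η (suc (suc s))) (fanGrid (suc (suc s)))  ≡⟨ cong₂ stepGrid η≡2 next ⟩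
    stepGrid 2 (beforeGrid (parity l) (parity s))       ≡⟨ stepGrid-before (parity l) (parity s) ⟩
    beforeGrid (parity l) (parity s ⁻¹)                 ≡⟨ cong (beforeGrid (parity l)) (ℙ.suc-homo-⁻¹ (suc s)) ⟩
    beforeGrid (parity l) (parity (suc s))              ∎
    where
    open ≡-Reasoning
    s+2+d+1≡l = trans (sym (ℕ.+-suc (suc s) (suc d))) s+1+d+2≡l
    next = fanGrid-before d (suc (suc s)) s+2+d+1≡l (s≤s z≤n)
    s+2<l : suc (suc s) < l
    s+2<l = subst (suc (suc (suc s)) ≤_) (trans (cong (suc ∘ suc) (sym (ℕ.+-suc s d))) s+2+d+1≡l)
                  (ℕ.m≤m+n (suc (suc (suc s))) d)
    η≡2 : η (suc (suc s)) ≡ 2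
    η≡2 = η-inner (suc (suc s)) (s≤s (s≤s z≤n)) (ℕ.<⇒≢ (ℕ.<-≤-trans s+2<l (ℕ.m≤n⇒m≤1+n l≤N))) (ℕ.<⇒≢ s+2<l)

  coeff-etaMonomial : (E : Graph n) → IsOuterplanarNearTriangulation E →
    (∀ (u i : Fin n) → toℕ u ≡ 0 → toℕ i ≢ 0 → E u i ≡ true) →
    coeff (graphPoly E) (etaMonomial n l) ≡ etaCoefficient (parity l)
  coeff-etaMonomial E ont hub = begin
    coeff (graphPoly E) (etaMonomial n l)
      ≡⟨ coeff-foldr-diffP _ (λ _ _ _ → refl) (edgeList E) (λ _ → refl) ⟩
    coeffProd n (map toℕ² (edgeList E)) η
      ≡⟨ cong (λ es → coeffProd n es η) (edgeList≡fanRows E (arc≡fanArc E ont hub)) ⟩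
    coeffProd n (concatMap (fanRow n) (interval 0 n)) η
      ≡⟨ cong (λ es → coeffProd n es η) (fanRows≡spokes++path N) ⟩
    coeffProd n (spokes 1 (suc N) ++ path 1 N) η
      ≡⟨ coeffProd-↭ n (spokes++path↭fanFrom N 1) η ⟩
    coeffProd n (fanFrom 1 N) η
      ≡⟨ coeffProd-cong n (fanFrom 1 N) initial ⟩
    table (fanGrid 1) 2 1
      ≡⟨ cong (λ G → table G 2 1) (fanGrid-before (l ∸ 2) 1 (ℕ.m+[n∸m]≡n 2≤l) (s≤s z≤n)) ⟩
    table (beforeGrid (parity l) 1ℙ) 2 1
      ≡⟨ entry (parity l) ⟩
    etaCoefficient (parity l)
      ∎
    where
    open ≡-Reasoning
    initial : η ≗ frontier η 1 2 1
    initial zero          = refl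
    initial (suc zero)    = refl
    initial (suc (suc v)) = refl
    entry : ∀ q → table (beforeGrid q 1ℙ) 2 1 ≡ etaCoefficient q
    entry 0ℙ = refl
    entry 1ℙ = refl

2∣⇒parity≡0ℙ : ∀ {n} → 2 ∣ n → parity n ≡ 0ℙ
2∣⇒parity≡0ℙ (divides q refl) = trans (ℙ.*-homo-* q 2) (ℙ.*-zeroʳ (parity q))

parity≡0ℙ⇒2∣ : ∀ n → parity n ≡ 0ℙ → 2 ∣ n
parity≡0ℙ⇒2∣ zero          _  = divides 0 refl
parity≡0ℙ⇒2∣ (suc (suc n)) eq = ∣m∣n⇒∣m+n ∣-refl (parity≡0ℙ⇒2∣ n eq)

etaCoefficient-spec : ∀ l →
  ((¬ etaCoefficient (parity l) ≡ 0ℤ) ⇔ 2 ∣ l) ×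
  (¬ etaCoefficient (parity l) ≡ 0ℤ → ∣ etaCoefficient (parity l) ∣ ≡ 1)
etaCoefficient-spec l with parity l in eq
... | 0ℙ = mk⇔ (λ _ → parity≡0ℙ⇒2∣ l eq) (λ _ ()) , λ _ → refl
... | 1ℙ = mk⇔ (λ ≢0 → ⊥-elim (≢0 refl)) (λ 2∣l → ⊥-elim (ℙ.p≢p⁻¹ 0ℙ (trans (sym (2∣⇒parity≡0ℙ 2∣l)) eq))) ,
           λ ≢0 → ⊥-elim (≢0 refl)

corollary4p10 : (k : ℕ) → 1 < k → (E : Graph (2 * k)) →
  IsOuterplanarNearTriangulation E →
  (∀ (u i : Fin (2 * k)) → toℕ u ≡ 0 → ¬ (toℕ i ≡ 0) → E u i ≡ true) →
  (∀ (i : Fin (2 * k)) → toℕ i ≡ 1 → deg E i ≡ 2) →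
  (∀ (i : Fin (2 * k)) → toℕ i ≡ 2 * k ∸ 1 → deg E i ≡ 2) →
  (l : ℕ) → 2 ≤ l → l < 2 * k ∸ 1 →
  ((¬ (coeff (graphPoly E) (etaMonomial (2 * k) l) ≡ ℤ+ 0)) ⇔ (2 ∣ l)) ×
  (¬ (coeff (graphPoly E) (etaMonomial (2 * k) l) ≡ ℤ+ 0) →
     ∣ coeff (graphPoly E) (etaMonomial (2 * k) l) ∣ ≡ 1)
corollary4p10 (suc zero) (s≤s ())
corollary4p10 (suc (suc k)) _ E ont hub _ _ l 2≤l (s≤s l≤N)
  rewrite coeff-etaMonomial _ l 2≤l l≤N (ℙ.*-homo-* 2 (suc (suc k))) E ont hub = etaCoefficient-spec l
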